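{- Let $r \ge 1$ and $k_1, \dots, k_r \ge 2$ be integers, and let $m \ge 2$ be an integer. If there exists a linear Ramsey $(k_1, k_2, \dots, k_r; m)$-graph $U$, then there exists a cyclic Ramsey $(k_1, k_2, \dots, k_r, 3; 3m-1)$-graph $W$.
   Context: Let $U$ be the complete graph $K_m$ on vertices $u_0, \dots, u_{m-1}$. A $q$-colouring of $U$ assigns to each edge one of the colours $1, \dots, q$. The length of the edge $(u_i,u_j)$ is $|j-i|$. A colouring is linear if the colour of every edge depends only on its length; write $c(l)$ for the colour of edges of length $l$ ($1 \le l \le m-1$). A colouring is cyclic if it is linear and $c(l) = c(m-l)$ for all $1 \le l \le m-1$. A Ramsey $(k_1, \dots, k_r; m)$-graph (with all $k_s \ge 2$) is the complete graph $K_m$ with an $r$-colouring of its edges such that, for each colour $s$ with $1 \le s \le r$, there is no complete subgraph on $k_s$ (or more) vertices all of whose edges have colour $s$. A linear (resp. cyclic) Ramsey graph is one whose colouring is linear (resp. cyclic) with respect to some ordering of its vertices. -}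

module Defs where

open import Data.Nat using (ℕ; suc; _+_; _∸_; _≤_; _<?_)
open import Data.Fin using (Fin; toℕ; fromℕ<)
open import Data.Product using (Σ; _×_; ∃)
open import Relation.Binary.PropositionalEquality using (_≡_; _≢_)
open import Relation.Nullary using (¬_; yes; no)
open import Function.Bundles using (_↔_; Inverse)
open import Function.Definitions using (Injective)

-- Given as a function on ordered pairs; values on the diagonal are ignored
-- and we require symmetry so that it really colours unordered edges.
record Colouring (m q : ℕ) : Set where
  field
    col : Fin m → Fin m → Fin q
    sym : ∀ i j → col i j ≡ col j i
open Colouring public

dist : ℕ → ℕ → ℕ
dist a b = (a ∸ b) + (b ∸ a)

-- linear w.r.t. the vertex ordering given by σ (σ i = u_i):
-- colour depends only on the length; c l is the colour of length l.
LinearWrt : ∀ {m q} → Colouring m q → (Fin m ↔ Fin m) → (ℕ → Fin q) → Set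
LinearWrt {m} C σ c =
  ∀ (i j : Fin m) → i ≢ j →
    col C (Inverse.to σ i) (Inverse.to σ j) ≡ c (dist (toℕ i) (toℕ j))

CyclicWrt : ∀ {m q} → Colouring m q → (Fin m ↔ Fin m) → (ℕ → Fin q) → Set
CyclicWrt {m} C σ c =
  LinearWrt C σ c × (∀ l → 1 ≤ l → l ≤ m ∸ 1 → c l ≡ c (m ∸ l))

Linear : ∀ {m q} → Colouring m q → Set
Linear {m} {q} C = Σ (Fin m ↔ Fin m) λ σ → Σ (ℕ → Fin q) λ c → LinearWrt C σ c

Cyclic : ∀ {m q} → Colouring m q → Set
Cyclic {m} {q} C = Σ (Fin m ↔ Fin m) λ σ → Σ (ℕ → Fin q) λ c → CyclicWrt C σ c

MonoClique : ∀ {m q} → Colouring m q → Fin q → ℕ → Set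
MonoClique {m} C s n =
  Σ (Fin n → Fin m) λ f → Injective _≡_ _≡_ f ×
    (∀ a b → a ≢ b → col C (f a) (f b) ≡ s)

-- Ramsey (k_1,...,k_q; m)-graph: no monochromatic K_{k_s} (or more) in colour s.
-- (A clique on more than k_s vertices contains one on k_s vertices; we
-- nevertheless exclude all sizes ≥ k_s literally.)
IsRamsey : ∀ {m q} → (Fin q → ℕ) → Colouring m q → Set
IsRamsey {m} {q} k C = ∀ (s : Fin q) (n : ℕ) → k s ≤ n → ¬ MonoClique C s n

snoc3 : ∀ {r} → (Fin r → ℕ) → Fin (suc r) → ℕ
snoc3 {r} k i with toℕ i <? r
... | yes p = k (fromℕ< p)
... | no _ = 3

-- Lay the vertices 0, …, N−1 (N = 3m−1) on a cycle and colour an edge whose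
-- cyclic length d = min(l, N − l) is below m with the colour c(d) it had in U,
-- and every other edge with the new colour. Three vertices pairwise at cyclic distance ≥ m would need
-- N ≥ 3m, so there is no triangle in the new colour. Vertices pairwise at
-- cyclic distance < m lie on an arc of m consecutive vertices (because
-- N ≥ 3m − 2); rotating that arc onto 0, …, m−1 preserves cyclic lengths,
-- which there coincide with ordinary lengths, so a monochromatic clique of an
-- old colour in W is a monochromatic clique of U.
module Submission where

open import Defs hiding (sym)
open import Data.Nat
  using (ℕ; zero; suc; _+_; _*_; _∸_; _⊓_; ∣_-_∣; _≤_; _<_; s≤s; _≤?_; _<?_)
open import Data.Nat.Properties hiding (_≟_)
open import Data.Fin using (Fin; zero; suc; toℕ; fromℕ; fromℕ<; inject₁; _≟_)
open import Data.Fin.Properties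
  using ( toℕ<n; toℕ-fromℕ; toℕ-fromℕ<; toℕ-inject₁; toℕ-injective
        ; fromℕ≢inject₁; inject₁-injective)
open import Data.Fin.Relation.Unary.Top using (view; ‵fromℕ; ‵inject₁)
open import Data.Product using (Σ; ∃-syntax; _×_; _,_; proj₁; proj₂)
open import Data.Sum using (_⊎_; inj₁; inj₂)
open import Relation.Nullary using (¬_; Dec; yes; no; contradiction)
open import Relation.Binary.PropositionalEquality
  using (_≡_; _≢_; refl; sym; trans; cong; cong₂; subst; module ≡-Reasoning)
open import Function.Base using (_∘_)
open import Function.Bundles using (_↔_; Inverse; Injection)
open import Function.Construct.Identity using (↔-id)
open import Function.Properties.Inverse using (↔⇒↣)

dist≡∣-∣ : ∀ a b → dist a b ≡ ∣ a - b ∣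
dist≡∣-∣ zero    zero    = refl
dist≡∣-∣ zero    (suc b) = refl
dist≡∣-∣ (suc a) zero    = +-identityʳ (suc a)
dist≡∣-∣ (suc a) (suc b) = dist≡∣-∣ a b

∣m-n∣<o : ∀ {m n o} → m < o → n < o → ∣ m - n ∣ < o
∣m-n∣<o {m} {n} m<o n<o = ≤-<-trans (∣m-n∣≤m⊔n m n) (⊔-pres-<m m<o n<o)

n≤m⇒m<n+o⇒m∸n<o : ∀ {m n o} → n ≤ m → m < n + o → m ∸ n < o
n≤m⇒m<n+o⇒m∸n<o {m} {n} {o} n≤m m<n+o =
  +-cancelˡ-< n (m ∸ n) o (subst (_< n + o) (sym (m+[n∸m]≡n n≤m)) m<n+o)

∣[m∸o]-[n∸o]∣≡∣m-n∣ : ∀ {m n o} → o ≤ m → o ≤ n → ∣ m ∸ o - n ∸ o ∣ ≡ ∣ m - n ∣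
∣[m∸o]-[n∸o]∣≡∣m-n∣ {m} {n} {o} o≤m o≤n = begin
  ∣ m ∸ o - n ∸ o ∣             ≡⟨ ∣m+n-m+o∣≡∣n-o∣ o (m ∸ o) (n ∸ o) ⟨
  ∣ o + (m ∸ o) - o + (n ∸ o) ∣ ≡⟨ cong₂ ∣_-_∣ (m+[n∸m]≡n o≤m) (m+[n∸m]≡n o≤n) ⟩
  ∣ m - n ∣                     ∎
  where open ≡-Reasoning

∣m+o-n+o∣≡∣m-n∣ : ∀ m n o → ∣ m + o - n + o ∣ ≡ ∣ m - n ∣
∣m+o-n+o∣≡∣m-n∣ m n o =
  trans (cong₂ ∣_-_∣ (+-comm m o) (+-comm n o)) (∣m+n-m+o∣≡∣n-o∣ o m n)

argmin : ∀ {n} (g : Fin (suc n) → ℕ) → ∃[ i ] (∀ j → g i ≤ g j)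
argmin {zero}  g = zero , λ { zero → ≤-refl }
argmin {suc n} g with argmin (λ j → g (suc j))
... | i , min with g zero ≤? g (suc i)
...   | yes g0≤ = zero  , λ { zero → ≤-refl ; (suc j) → ≤-trans g0≤ (min j) }
...   | no  g0≰ = suc i , λ { zero → <⇒≤ (≰⇒> g0≰) ; (suc j) → min j }

cyclicLength : ℕ → ℕ → ℕ
cyclicLength N l = l ⊓ (N ∸ l)

cyclicLength-complement : ∀ {N l} → l ≤ N → cyclicLength N (N ∸ l) ≡ cyclicLength N l
cyclicLength-complement {N} {l} l≤N =
  trans (cong ((N ∸ l) ⊓_) (m∸[m∸n]≡n l≤N)) (⊓-comm (N ∸ l) l)

cyclicLength≡0⇒≡0 : ∀ {N l} → l < N → cyclicLength N l ≡ 0 → l ≡ 0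
cyclicLength≡0⇒≡0 {N} {l} l<N eq with ⊓-sel l (N ∸ l)
... | inj₁ ⊓≡l   = trans (sym ⊓≡l) eq
... | inj₂ ⊓≡N∸l = contradiction (m∸n≡0⇒m≤n (trans (sym ⊓≡N∸l) eq)) (<⇒≱ l<N)

cyclicLength-short : ∀ {N m l} → m + m ≤ suc N → l < m → cyclicLength N l ≡ l
cyclicLength-short {N} {m} {l} 2m≤1+N l<m =
  m≤n⇒m⊓n≡m (m+n≤o⇒m≤o∸n l (≤-pred (≤-trans (+-mono-< l<m l<m) 2m≤1+N)))

cyclicLength<⇒N<l+m : ∀ {N m l} → m ≤ l → cyclicLength N l < m → N < l + m
cyclicLength<⇒N<l+m {N} {m} {l} m≤l len<m with ⊓-sel l (N ∸ l)
... | inj₁ ⊓≡l   = contradiction (subst (_< m) ⊓≡l len<m) (≤⇒≯ m≤l)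
... | inj₂ ⊓≡N∸l = ≤-<-trans (m≤n+m∸n N l) (+-monoʳ-< l (subst (_< m) ⊓≡N∸l len<m))

-- m ≤ cyclicLength N ∣ x - y ∣, stated without truncated subtraction
Far : ℕ → ℕ → ℕ → ℕ → Set
Far N m x y = m ≤ ∣ x - y ∣ × m + ∣ x - y ∣ ≤ N

m≤cyclicLength⇒Far : ∀ {N m} x y → ∣ x - y ∣ ≤ N → m ≤ cyclicLength N ∣ x - y ∣ → Far N m x y
m≤cyclicLength⇒Far {N} {m} x y l≤N m≤len =
  m≤n⊓o⇒m≤n _ _ m≤len , m≤o∸n⇒m+n≤o m l≤N (m≤n⊓o⇒m≤o ∣ x - y ∣ _ m≤len)

Far-sym : ∀ {N m} x y → Far N m x y → Far N m y x
Far-sym {N} {m} x y = subst (λ l → m ≤ l × m + l ≤ N) (∣-∣-comm x y)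

Far-sorted⇒3m≤N : ∀ {N m} x y z → x ≤ y → y ≤ z →
  Far N m x y → Far N m y z → Far N m x z → 3 * m ≤ N
Far-sorted⇒3m≤N {N} {m} x _ _ x≤y y≤z (m≤∣x-y∣ , _) (m≤∣y-z∣ , _) (_ , m+∣x-z∣≤N)
  with d₁ , refl ← m≤n⇒∃[o]m+o≡n x≤y
     | d₂ , refl ← m≤n⇒∃[o]m+o≡n y≤z = begin
  m + (m + (m + 0))         ≡⟨ cong (λ k → m + (m + k)) (+-identityʳ m) ⟩
  m + (m + m)               ≤⟨ +-monoʳ-≤ m (+-mono-≤ m≤d₁ m≤d₂) ⟩
  m + (d₁ + d₂)             ≡⟨ cong (m +_) (∣m-m+n∣≡n x (d₁ + d₂)) ⟨
  m + ∣ x - x + (d₁ + d₂) ∣ ≡⟨ cong (λ z → m + ∣ x - z ∣) (+-assoc x d₁ d₂) ⟨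
  m + ∣ x - x + d₁ + d₂ ∣   ≤⟨ m+∣x-z∣≤N ⟩
  N                         ∎
  where
  open ≤-Reasoning
  m≤d₁ : m ≤ d₁
  m≤d₁ = subst (m ≤_) (∣m-m+n∣≡n x d₁) m≤∣x-y∣
  m≤d₂ : m ≤ d₂
  m≤d₂ = subst (m ≤_) (∣m-m+n∣≡n (x + d₁) d₂) m≤∣y-z∣

pairwiseFar⇒3m≤N : ∀ {N m} x y z → Far N m x y → Far N m y z → Far N m x z → 3 * m ≤ N
pairwiseFar⇒3m≤N x y z xy yz xz with ≤-total x y | ≤-total y z | ≤-total x z
... | inj₁ x≤y | inj₁ y≤z | _       = Far-sorted⇒3m≤N x y z x≤y y≤z xy yz xz
... | inj₁ x≤y | inj₂ z≤y | inj₁ x≤z =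
  Far-sorted⇒3m≤N x z y x≤z z≤y xz (Far-sym y z yz) xy
... | inj₁ x≤y | inj₂ z≤y | inj₂ z≤x =
  Far-sorted⇒3m≤N z x y z≤x x≤y (Far-sym x z xz) xy (Far-sym y z yz)
... | inj₂ y≤x | inj₁ y≤z | inj₁ x≤z =
  Far-sorted⇒3m≤N y x z y≤x x≤z (Far-sym x y xy) xz yz
... | inj₂ y≤x | inj₁ y≤z | inj₂ z≤x =
  Far-sorted⇒3m≤N y z x y≤z z≤x yz (Far-sym x z xz) (Far-sym x y xy)
... | inj₂ y≤x | inj₂ z≤y | _       =
  Far-sorted⇒3m≤N z y x z≤y y≤x (Far-sym y z yz) (Far-sym x y xy) (Far-sym x z xz)

rotate : ℕ → ℕ → ℕ → ℕ
rotate N q x with q ≤? x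
... | yes _ = x ∸ q
... | no  _ = x + N ∸ q

rotate-≥ : ∀ {N q x} → q ≤ x → rotate N q x ≡ x ∸ q
rotate-≥ {N} {q} {x} q≤x with q ≤? x
... | yes _   = refl
... | no  q≰x = contradiction q≤x q≰x

rotate-< : ∀ {N q x} → x < q → rotate N q x ≡ x + N ∸ q
rotate-< {N} {q} {x} x<q with q ≤? x
... | yes q≤x = contradiction q≤x (<⇒≱ x<q)
... | no  _   = refl

∣rotate-rotate∣-straddle : ∀ {N q x y} → y < q → q ≤ x → x < N →
  ∣ rotate N q x - rotate N q y ∣ ≡ N ∸ ∣ x - y ∣
∣rotate-rotate∣-straddle {N} {q} {x} {y} y<q q≤x x<N
  with b , refl ← m≤n⇒∃[o]m+o≡n (<⇒≤ y<q)
     | a , refl ← m≤n⇒∃[o]m+o≡n q≤x = begin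
  ∣ rotate N (y + b) (y + b + a) - rotate N (y + b) y ∣
    ≡⟨ cong₂ ∣_-_∣ (trans (rotate-≥ q≤x) (m+n∸m≡n (y + b) a)) (rotate-< y<q) ⟩
  ∣ a - y + N ∸ (y + b) ∣ ≡⟨ cong ∣ a -_∣ ([m+n]∸[m+o]≡n∸o y N b) ⟩
  ∣ a - N ∸ b ∣           ≡⟨ m≤n⇒∣m-n∣≡n∸m a≤N∸b ⟩
  N ∸ b ∸ a               ≡⟨ ∸-+-assoc N b a ⟩
  N ∸ (b + a)             ≡⟨ cong (N ∸_) ∣x-y∣≡b+a ⟨
  N ∸ ∣ y + b + a - y ∣   ∎
  where
  open ≡-Reasoning
  ∣x-y∣≡b+a : ∣ y + b + a - y ∣ ≡ b + a
  ∣x-y∣≡b+a = begin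
    ∣ y + b + a - y ∣   ≡⟨ ∣-∣-comm (y + b + a) y ⟩
    ∣ y - y + b + a ∣   ≡⟨ cong ∣ y -_∣ (+-assoc y b a) ⟩
    ∣ y - y + (b + a) ∣ ≡⟨ ∣m-m+n∣≡n y (b + a) ⟩
    b + a               ∎
  a≤N∸b : a ≤ N ∸ b
  a≤N∸b = m+n≤o⇒m≤o∸n a (subst (_≤ N) (+-comm b a)
            (m+n≤o⇒n≤o y (subst (_≤ N) (+-assoc y b a) (<⇒≤ x<N))))

∣rotate-rotate∣ : ∀ {N q x y} → q ≤ N → x < N → y < N →
  ∣ rotate N q x - rotate N q y ∣ ≡ ∣ x - y ∣ ⊎ ∣ rotate N q x - rotate N q y ∣ ≡ N ∸ ∣ x - y ∣
∣rotate-rotate∣ {N} {q} {x} {y} q≤N x<N y<N with x <? q | y <? q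
... | no  x≮q | no  y≮q =
  inj₁ (trans (cong₂ ∣_-_∣ (rotate-≥ (≮⇒≥ x≮q)) (rotate-≥ (≮⇒≥ y≮q)))
              (∣[m∸o]-[n∸o]∣≡∣m-n∣ (≮⇒≥ x≮q) (≮⇒≥ y≮q)))
... | yes x<q | yes y<q = inj₁ (begin
  ∣ rotate N q x - rotate N q y ∣     ≡⟨ cong₂ ∣_-_∣ (rotate-< x<q) (rotate-< y<q) ⟩
  ∣ x + N ∸ q - y + N ∸ q ∣           ≡⟨ cong₂ ∣_-_∣ (+-∸-assoc x q≤N) (+-∸-assoc y q≤N) ⟩
  ∣ x + (N ∸ q) - y + (N ∸ q) ∣       ≡⟨ ∣m+o-n+o∣≡∣m-n∣ x y (N ∸ q) ⟩
  ∣ x - y ∣                           ∎)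
  where open ≡-Reasoning
... | no  x≮q | yes y<q = inj₂ (∣rotate-rotate∣-straddle y<q (≮⇒≥ x≮q) x<N)
... | yes x<q | no  y≮q = inj₂ (begin
  ∣ rotate N q x - rotate N q y ∣ ≡⟨ ∣-∣-comm (rotate N q x) (rotate N q y) ⟩
  ∣ rotate N q y - rotate N q x ∣ ≡⟨ ∣rotate-rotate∣-straddle x<q (≮⇒≥ y≮q) y<N ⟩
  N ∸ ∣ y - x ∣                   ≡⟨ cong (N ∸_) (∣-∣-comm y x) ⟩
  N ∸ ∣ x - y ∣                   ∎)
  where open ≡-Reasoning

cyclicLength-rotate : ∀ {N q x y} → q ≤ N → x < N → y < N →
  cyclicLength N ∣ rotate N q x - rotate N q y ∣ ≡ cyclicLength N ∣ x - y ∣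
cyclicLength-rotate {N} q≤N x<N y<N with ∣rotate-rotate∣ q≤N x<N y<N
... | inj₁ eq = cong (cyclicLength N) eq
... | inj₂ eq =
  trans (cong (cyclicLength N) eq) (cyclicLength-complement (<⇒≤ (∣m-n∣<o x<N y<N)))

pairwiseClose⇒inArc : ∀ {N m n} → 3 * m ≤ 2 + N →
  (x : Fin (suc n) → ℕ) → (∀ a → x a < N) → (∀ a b → cyclicLength N ∣ x a - x b ∣ < m) →
  ∃[ q ] q < N × (∀ a → rotate N q (x a) < m)
pairwiseClose⇒inArc {N} {m} {n} 3m≤2+N x x<N close =
  q , x<N iq , λ a → inArc (x₀ + m ≤? q) (x₀ + m ≤? x a) (x<N a) (close a iq) (q-minimal a)
  where
  open ≤-Reasoning
  i₀ : Fin (suc n)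
  i₀ = proj₁ (argmin x)
  x₀ : ℕ
  x₀ = x i₀

  -- Starting at x₀ + m, walk once around the cycle; q is the first vertex met.
  key : ∀ {w} → Dec (x₀ + m ≤ w) → ℕ
  key {w} (yes _) = w
  key {w} (no  _) = w + N

  iq : Fin (suc n)
  iq = proj₁ (argmin (λ a → key (x₀ + m ≤? x a)))
  q : ℕ
  q = x iq

  q-minimal : ∀ a → key (x₀ + m ≤? q) ≤ key (x₀ + m ≤? x a)
  q-minimal = proj₂ (argmin (λ a → key (x₀ + m ≤? x a)))

  x₀≤q : x₀ ≤ q
  x₀≤q = proj₂ (argmin x) iq

  ∣x₀-q∣≡q∸x₀ : ∣ x₀ - q ∣ ≡ q ∸ x₀
  ∣x₀-q∣≡q∸x₀ = m≤n⇒∣m-n∣≡n∸m x₀≤q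

  ahead⇒N<∣x₀-q∣+m : x₀ + m ≤ q → N < ∣ x₀ - q ∣ + m
  ahead⇒N<∣x₀-q∣+m q-ahead = cyclicLength<⇒N<l+m
    (subst (m ≤_) (sym ∣x₀-q∣≡q∸x₀) (m+n≤o⇒m≤o∸n m (subst (_≤ q) (+-comm x₀ m) q-ahead)))
    (close i₀ iq)

  2m≤1+t : ∀ {t} → N < t + m → m + m ≤ suc t
  2m≤1+t {t} N<t+m = +-cancelʳ-≤ m (m + m) (suc t) (begin
    m + m + m         ≡⟨ cong (_+ m) (cong (m +_) (+-identityʳ m)) ⟨
    m + (m + 0) + m   ≡⟨ +-comm (m + (m + 0)) m ⟩
    3 * m             ≤⟨ 3m≤2+N ⟩
    2 + N             ≤⟨ s≤s N<t+m ⟩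
    suc t + m         ∎)

  behind⇒w+m≤q : ∀ {w} → x₀ + m ≤ q → w < x₀ + m → w + m ≤ q
  behind⇒w+m≤q {w} q-ahead w<x₀+m = ≤-pred (begin
    suc w + m         ≤⟨ +-monoˡ-≤ m w<x₀+m ⟩
    x₀ + m + m        ≡⟨ +-assoc x₀ m m ⟩
    x₀ + (m + m)      ≤⟨ +-monoʳ-≤ x₀ (2m≤1+t (ahead⇒N<∣x₀-q∣+m q-ahead)) ⟩
    x₀ + suc ∣ x₀ - q ∣ ≡⟨ cong (λ t → x₀ + suc t) ∣x₀-q∣≡q∸x₀ ⟩
    x₀ + suc (q ∸ x₀) ≡⟨ +-suc x₀ (q ∸ x₀) ⟩
    suc (x₀ + (q ∸ x₀)) ≡⟨ cong suc (m+[n∸m]≡n x₀≤q) ⟩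
    suc q             ∎)

  inArc : ∀ {w} (q? : Dec (x₀ + m ≤ q)) (w? : Dec (x₀ + m ≤ w)) → w < N →
    cyclicLength N ∣ w - q ∣ < m → key q? ≤ key w? → rotate N q w < m
  inArc {w} (yes q-ahead) (yes _) w<N _ q≤w =
    subst (_< m) (sym (rotate-≥ q≤w)) (n≤m⇒m<n+o⇒m∸n<o q≤w (begin-strict
      w                 <⟨ w<N ⟩
      N                 <⟨ ahead⇒N<∣x₀-q∣+m q-ahead ⟩
      ∣ x₀ - q ∣ + m    ≡⟨ cong (_+ m) ∣x₀-q∣≡q∸x₀ ⟩
      q ∸ x₀ + m        ≤⟨ +-monoˡ-≤ m (m∸n≤m q x₀) ⟩
      q + m             ∎))
  inArc {w} (yes q-ahead) (no w-behind) w<N w-close _ =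
    subst (_< m) (sym (rotate-< w<q)) (n≤m⇒m<n+o⇒m∸n<o q≤w+N (begin-strict
      w + N             <⟨ +-monoʳ-< w (cyclicLength<⇒N<l+m m≤∣w-q∣ w-close) ⟩
      w + (∣ w - q ∣ + m) ≡⟨ cong (λ l → w + (l + m)) (m≤n⇒∣m-n∣≡n∸m (<⇒≤ w<q)) ⟩
      w + (q ∸ w + m)   ≡⟨ +-assoc w (q ∸ w) m ⟨
      w + (q ∸ w) + m   ≡⟨ cong (_+ m) (m+[n∸m]≡n (<⇒≤ w<q)) ⟩
      q + m             ∎))
    where
    q≤w+N : q ≤ w + N
    q≤w+N = ≤-trans (<⇒≤ (x<N iq)) (m≤n+m N w)
    w+m≤q : w + m ≤ q
    w+m≤q = behind⇒w+m≤q q-ahead (≰⇒> w-behind)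
    w<q : w < q
    w<q = <-≤-trans (≰⇒> w-behind) q-ahead
    m≤∣w-q∣ : m ≤ ∣ w - q ∣
    m≤∣w-q∣ = subst (m ≤_) (sym (m≤n⇒∣m-n∣≡n∸m (<⇒≤ w<q)))
                    (m+n≤o⇒m≤o∸n m (subst (_≤ q) (+-comm w m) w+m≤q))
  inArc (no _) (yes _) w<N _ q+N≤w = contradiction (≤-trans (m≤n+m N q) q+N≤w) (<⇒≱ w<N)
  inArc {w} (no _) (no w-behind) _ _ q+N≤w+N = begin-strict
    rotate N q w ≡⟨ rotate-≥ q≤w ⟩
    w ∸ q   ≤⟨ ∸-monoʳ-≤ w x₀≤q ⟩
    w ∸ x₀  <⟨ n≤m⇒m<n+o⇒m∸n<o (≤-trans x₀≤q q≤w) (≰⇒> w-behind) ⟩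
    m       ∎
    where
    q≤w : q ≤ w
    q≤w = +-cancelʳ-≤ N q w q+N≤w+N

snoc3-fromℕ : ∀ {r} (k : Fin r → ℕ) → snoc3 k (fromℕ r) ≡ 3
snoc3-fromℕ {r} k with toℕ (fromℕ r) <? r
... | yes r<r = contradiction (subst (_< r) (toℕ-fromℕ r) r<r) (<-irrefl refl)
... | no  _   = refl

snoc3-inject₁ : ∀ {r} (k : Fin r → ℕ) (s : Fin r) → snoc3 k (inject₁ s) ≡ k s
snoc3-inject₁ {r} k s with toℕ (inject₁ s) <? r
... | yes s<r = cong k (toℕ-injective (trans (toℕ-fromℕ< s<r) (toℕ-inject₁ s)))
... | no  s≮r = contradiction (subst (_< r) (sym (toℕ-inject₁ s)) (toℕ<n s)) s≮r

module CyclicExtension {m r : ℕ} (U : Colouring m r) (σ : Fin m ↔ Fin m) (c : ℕ → Fin r)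
  (U-linear : LinearWrt U σ c) (N : ℕ) (3m≡1+N : 3 * m ≡ suc N) where

  extendedColour : ℕ → Fin (suc r)
  extendedColour d with d <? m
  ... | yes _ = inject₁ (c d)
  ... | no  _ = fromℕ r

  extendedColour≡inject₁ : ∀ {d s} → extendedColour d ≡ inject₁ s → d < m × c d ≡ s
  extendedColour≡inject₁ {d} eq with d <? m
  ... | yes d<m = d<m , inject₁-injective eq
  ... | no  _   = contradiction eq fromℕ≢inject₁

  extendedColour≡fromℕ : ∀ {d} → extendedColour d ≡ fromℕ r → m ≤ d
  extendedColour≡fromℕ {d} eq with d <? m
  ... | yes _   = contradiction (sym eq) fromℕ≢inject₁
  ... | no  d≮m = ≮⇒≥ d≮m

  colourOfLength : ℕ → Fin (suc r)
  colourOfLength l = extendedColour (cyclicLength N l)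

  W : Colouring N (suc r)
  W = record
    { col = λ i j → colourOfLength ∣ toℕ i - toℕ j ∣
    ; sym = λ i j → cong colourOfLength (∣-∣-comm (toℕ i) (toℕ j))
    }

  W-cyclic : Cyclic W
  W-cyclic = ↔-id (Fin N) , colourOfLength
    , (λ i j _ → cong colourOfLength (sym (dist≡∣-∣ (toℕ i) (toℕ j))))
    , λ l _ l≤N∸1 →
        cong extendedColour (sym (cyclicLength-complement (≤-trans l≤N∸1 (m∸n≤m N 1))))

  N<3m : N < 3 * m
  N<3m = subst (N <_) (sym 3m≡1+N) ≤-refl

  noNewTriangle : ∀ {n} → 3 ≤ n → ¬ MonoClique W (fromℕ r) n
  noNewTriangle (s≤s (s≤s (s≤s _))) (f , _ , f-col) =
    <⇒≱ N<3m (pairwiseFar⇒3m≤N (x v₀) (x v₁) (x v₂)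
                                (far v₀ v₁ λ ()) (far v₁ v₂ λ ()) (far v₀ v₂ λ ()))
    where
    v₀ v₁ v₂ : Fin _
    v₀ = zero
    v₁ = suc zero
    v₂ = suc (suc zero)
    x : Fin _ → ℕ
    x a = toℕ (f a)
    far : ∀ a b → a ≢ b → Far N m (x a) (x b)
    far a b a≢b = m≤cyclicLength⇒Far (x a) (x b) (<⇒≤ (∣m-n∣<o (toℕ<n (f a)) (toℕ<n (f b))))
                                     (extendedColour≡fromℕ (f-col a b a≢b))

  0<m : 0 < m
  0<m = n≢0⇒n>0 λ m≡0 → 0≢1+n (trans (cong (3 *_) (sym m≡0)) 3m≡1+N)

  3m≤2+N : 3 * m ≤ 2 + N
  3m≤2+N = subst (_≤ 2 + N) (sym 3m≡1+N) (n≤1+n (suc N))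

  2m≤1+N : m + m ≤ suc N
  2m≤1+N = subst (m + m ≤_) 3m≡1+N (+-monoʳ-≤ m (m≤m+n m (m + 0)))

  oldClique⇒U-clique : ∀ {s n} → MonoClique W (inject₁ s) n → MonoClique U s n
  oldClique⇒U-clique {n = zero} _ = (λ ()) , (λ { {()} }) , λ ()
  oldClique⇒U-clique {s} {suc n} (f , f-inj , f-col) = g , g-inj , g-col
    where
    open ≡-Reasoning
    x : Fin (suc n) → ℕ
    x a = toℕ (f a)
    x<N : ∀ a → x a < N
    x<N a = toℕ<n (f a)

    close : ∀ a b → cyclicLength N ∣ x a - x b ∣ < m
    close a b with a ≟ b
    ... | yes refl = subst (λ l → cyclicLength N l < m) (sym (∣n-n∣≡0 (x a))) 0<m
    ... | no  a≢b  = proj₁ (extendedColour≡inject₁ (f-col a b a≢b))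

    arc : ∃[ q ] q < N × (∀ a → rotate N q (x a) < m)
    arc = pairwiseClose⇒inArc 3m≤2+N x x<N close
    q : ℕ
    q = proj₁ arc
    q<N : q < N
    q<N = proj₁ (proj₂ arc)
    rotated<m : ∀ a → rotate N q (x a) < m
    rotated<m = proj₂ (proj₂ arc)

    p : Fin (suc n) → Fin m
    p a = fromℕ< (rotated<m a)

    ∣p-p∣ : ∀ a b → ∣ toℕ (p a) - toℕ (p b) ∣ ≡ cyclicLength N ∣ x a - x b ∣
    ∣p-p∣ a b = begin
      ∣ toℕ (p a) - toℕ (p b) ∣
        ≡⟨ cong₂ ∣_-_∣ (toℕ-fromℕ< (rotated<m a)) (toℕ-fromℕ< (rotated<m b)) ⟩
      ∣ rotate N q (x a) - rotate N q (x b) ∣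
        ≡⟨ cyclicLength-short 2m≤1+N (∣m-n∣<o (rotated<m a) (rotated<m b)) ⟨
      cyclicLength N ∣ rotate N q (x a) - rotate N q (x b) ∣
        ≡⟨ cyclicLength-rotate (<⇒≤ q<N) (x<N a) (x<N b) ⟩
      cyclicLength N ∣ x a - x b ∣ ∎

    p-inj : ∀ {a b} → p a ≡ p b → a ≡ b
    p-inj {a} {b} pa≡pb = f-inj (toℕ-injective (∣m-n∣≡0⇒m≡n
      (cyclicLength≡0⇒≡0 (∣m-n∣<o (x<N a) (x<N b)) (begin
        cyclicLength N ∣ x a - x b ∣ ≡⟨ ∣p-p∣ a b ⟨
        ∣ toℕ (p a) - toℕ (p b) ∣   ≡⟨ cong (λ i → ∣ toℕ i - toℕ (p b) ∣) pa≡pb ⟩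
        ∣ toℕ (p b) - toℕ (p b) ∣   ≡⟨ ∣n-n∣≡0 (toℕ (p b)) ⟩
        0                           ∎))))

    g : Fin (suc n) → Fin m
    g = Inverse.to σ ∘ p

    g-inj : ∀ {a b} → g a ≡ g b → a ≡ b
    g-inj = p-inj ∘ Injection.injective (↔⇒↣ σ)

    g-col : ∀ a b → a ≢ b → col U (g a) (g b) ≡ s
    g-col a b a≢b = begin
      col U (g a) (g b)                ≡⟨ U-linear (p a) (p b) (a≢b ∘ p-inj) ⟩
      c (dist (toℕ (p a)) (toℕ (p b))) ≡⟨ cong c (dist≡∣-∣ (toℕ (p a)) (toℕ (p b))) ⟩
      c ∣ toℕ (p a) - toℕ (p b) ∣      ≡⟨ cong c (∣p-p∣ a b) ⟩
      c (cyclicLength N ∣ x a - x b ∣) ≡⟨ proj₂ (extendedColour≡inject₁ (f-col a b a≢b)) ⟩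
      s                                ∎

  W-ramsey : ∀ {k} → IsRamsey k U → IsRamsey (snoc3 k) W
  W-ramsey {k} U-ramsey s n k≤n clique with view s
  ... | ‵fromℕ      = noNewTriangle (subst (_≤ n) (snoc3-fromℕ k) k≤n) clique
  ... | ‵inject₁ s′ =
    U-ramsey s′ n (subst (_≤ n) (snoc3-inject₁ k s′) k≤n) (oldClique⇒U-clique clique)

theorem1 : (r : ℕ) → 1 ≤ r → (k : Fin r → ℕ) → (∀ s → 2 ≤ k s) →
    (m : ℕ) → 2 ≤ m →
    Σ (Colouring m r) (λ U → Linear U × IsRamsey k U) →
    Σ (Colouring (3 * m ∸ 1) (suc r)) (λ W → Cyclic W × IsRamsey (snoc3 k) W)
theorem1 _ _ _ _ zero    ()
theorem1 _ _ _ _ (suc m) _ (U , (σ , c , U-linear) , U-ramsey) =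
  W , W-cyclic , W-ramsey U-ramsey
  where open CyclicExtension U σ c U-linear (3 * suc m ∸ 1) refl
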